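{- Let $n\ge 1$ and let $(A;B;C;D)\in BS(n+1,n)$. Let $(\tilde C;\tilde D)$ be the pair of $\{\pm1\}$-sequences of length $n$ obtained from $(C;D)$ as follows: for every index $i\le \lfloor n/2\rfloor$ such that the $i$-th quad of $(C;D)$ has label $4$ or $5$, replace it by the quad with the other label (i.e. negate the four entries $c_i,c_{n+1-i},d_i,d_{n+1-i}$); all other quads, and the central column when $n$ is odd, are left unchanged. Then $N_{\tilde C}+N_{\tilde D}=N_C+N_D$; in particular $(A;B;\tilde C;\tilde D)\in BS(n+1,n)$.
   Context: For a finite sequence $X=x_1,\dots,x_k$ of integers, its nonperiodic autocorrelation function is $N_X(i)=\sum_{j\in\mathbb Z}x_jx_{i+j}$ for $i\in\mathbb Z$, where $x_j=0$ for $j<1$ or $j>k$. A binary sequence is a sequence with entries in $\{\pm1\}$. $BS(n+1,n)$ is the set of quadruples $(A;B;C;D)$ of binary sequences, $A,B$ of length $n+1$ and $C,D$ of length $n$, with $N_A(i)+N_B(i)+N_C(i)+N_D(i)=0$ for all $i\neq 0$. For a pair $(C;D)$ of binary sequences of length $n$, its $i$-th quad ($1\le i\le\lfloor n/2\rfloor$) is the $2\times2$ array $\begin{bmatrix} c_i & c_{n+1-i}\\ d_i & d_{n+1-i}\end{bmatrix}$; when $n$ is odd, $n=2m+1$, the central column is $(c_{m+1},d_{m+1})^T$. It is a known fact that for base sequences in $BS(n+1,n)$ the entries of each quad of $(C;D)$ sum to $0\pmod 4$, so each such quad is one of the eight BS-quads, labelled (rows written as top row / bottom row): $1=(+,+/+,+)$,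 $2=(+,+/-,-)$, $3=(-,+/-,+)$, $4=(+,-/-,+)$, $5=(-,+/+,-)$, $6=(+,-/+,-)$, $7=(-,-/+,+)$, $8=(-,-/-,-)$. -}

module Defs where

open import Data.Nat as ℕ using (ℕ; zero; suc; _<?_)
open import Data.Integer as ℤ using (ℤ; +_; -[1+_]; 0ℤ; 1ℤ; -1ℤ; _+_; _*_)
open import Data.Sign as S using (Sign)
open import Data.Fin as F using (Fin; toℕ; fromℕ<)
open import Data.Vec using (Vec; lookup; tabulate)
open import Data.List using (List; []; _∷_; map; upTo)
open import Data.Bool using (Bool; true; false; if_then_else_; _∨_)
open import Relation.Nullary using (yes; no)
open import Relation.Binary.PropositionalEquality using (_≡_; _≢_)

val : Sign → ℤ
val S.+ = 1ℤ
val S.- = -1ℤ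

-- x_j for j ∈ ℤ, 1-indexed, and 0 outside 1..k
at : {k : ℕ} → Vec Sign k → ℤ → ℤ
at {k} X (+ zero) = 0ℤ
at {k} X (+ suc m) with m <? k
... | yes p = val (lookup X (fromℕ< p))
... | no _  = 0ℤ
at {k} X -[1+ _ ] = 0ℤ

sumℤ : List ℤ → ℤ
sumℤ [] = 0ℤ
sumℤ (x ∷ xs) = x + sumℤ xs

-- nonperiodic autocorrelation N_X(i) = Σ_j x_j x_{i+j}
-- (terms with j outside 1..k vanish, so the sum is over j = 1..k)
N : {k : ℕ} → Vec Sign k → ℤ → ℤ
N {k} X i = sumℤ (map (λ j → at X (+ suc j) * at X (+ suc j + i)) (upTo k))

IsBS : (n : ℕ) → Vec Sign (suc n) → Vec Sign (suc n) → Vec Sign n → Vec Sign n → Set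
IsBS n A B C D = ∀ (i : ℤ) → i ≢ 0ℤ → N A i + N B i + N C i + N D i ≡ 0ℤ

_==_ : Sign → Sign → Bool
S.+ == S.+ = true
S.- == S.- = true
_   == _   = false

-- quad (top-left, top-right / bottom-left, bottom-right) has label 4 = (+,-/-,+)
isLabel4 : Sign → Sign → Sign → Sign → Bool
isLabel4 a b c d = if a == S.+ then (if b == S.- then (if c == S.- then d == S.+ else false) else false) else false

isLabel5 : Sign → Sign → Sign → Sign → Bool
isLabel5 a b c d = if a == S.- then (if b == S.+ then (if c == S.+ then d == S.- else false) else false) else false

isLabel45 : Sign → Sign → Sign → Sign → Bool
isLabel45 a b c d = isLabel4 a b c d ∨ isLabel5 a b c d

-- Position k (0-indexed, i.e. 1-indexed position toℕ k + 1) belongs to the quad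
-- with columns k and F.opposite k (1-indexed: i and n+1-i).  The quad index is the
-- smaller of the two; the central position (k = opposite k) belongs to no quad.
-- inQuad45 C D k = true iff k lies in a quad of (C;D) whose label is 4 or 5.
inQuad45 : {n : ℕ} → Vec Sign n → Vec Sign n → Fin n → Bool
inQuad45 C D k with toℕ k <? toℕ (F.opposite k)
... | yes _ = isLabel45 (lookup C k) (lookup C (F.opposite k)) (lookup D k) (lookup D (F.opposite k))
... | no _ with toℕ (F.opposite k) <? toℕ k
...   | yes _ = isLabel45 (lookup C (F.opposite k)) (lookup C k) (lookup D (F.opposite k)) (lookup D k)
...   | no _  = false

swap45 : {n : ℕ} → Vec Sign n → Vec Sign n → Vec Sign n → Vec Sign n
swap45 C D X = tabulate (λ k → if inQuad45 C D k then S.opposite (lookup X k) else lookup X k)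

C̃ : {n : ℕ} → Vec Sign n → Vec Sign n → Vec Sign n
C̃ C D = swap45 C D C

D̃ : {n : ℕ} → Vec Sign n → Vec Sign n → Vec Sign n
D̃ C D = swap45 C D D

-- Put ε_p = -1 if position p lies in a quad of label 4 or 5 and ε_p = 1 otherwise; ε is
-- constant on quads, and c̃_p = ε_p c_p, d̃_p = ε_p d_p. The change of N_C(i) + N_D(i) is the
-- sum over j of (ε_j ε_{j+i} - 1)(c_j c_{j+i} + d_j d_{j+i}). Pair the term of (j, j+i) with
-- the term of the mirror pair (n+1-j-i, n+1-j): both carry the factor ε_j ε_{j+i} - 1, which
-- vanishes unless exactly one of the two quads involved has label 4 or 5, and then the
-- remaining cross sum vanishes, because in a quad with product + the difference c - d
-- changes sign between the two columns exactly for labels 4 and 5. Negative i reduce to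
-- positive ones since N_X(-i) = N_X(i).
--
-- That every quad of (C;D) has product + follows from the BS condition: for each lag s ≥ 1
-- the product of all terms x_j x_{j+s} of A, B, C, D is -1 by a parity count, the ratio of
-- these products at lags s and s + 1 is the product of the s-th quads of (A;B) and (C;D),
-- and the mirror symmetry of the quads propagates the conclusion from the outermost quad
-- inwards.
module Submission where

open import Algebra.Bundles using (CommutativeMonoid)
open import Data.Bool using (Bool; true; false; if_then_else_)
open import Data.Fin as Fin using (Fin; toℕ; fromℕ<)
import Data.Fin.Properties as FinP
open FinP using (toℕ<n; toℕ-fromℕ<; fromℕ<-toℕ; opposite-prop; opposite-involutive)
open import Data.Integer using (ℤ; +_; -[1+_]; 0ℤ; 1ℤ; -1ℤ; _+_; _*_; -_; _-_)
import Data.Integer.Properties as ℤP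
open import Data.Integer.Tactic.RingSolver using (solve-∀)
import Data.Nat.Tactic.RingSolver as ℕ-Solver
open import Data.List using (map; applyUpTo)
open import Data.Nat as ℕ using (ℕ; zero; suc; _∸_; _≤_; _<_; _≥_; z≤n; s≤s; _<?_)
import Data.Nat.Properties as ℕP
open import Data.Product using (Σ-syntax; _×_; _,_)
open import Data.Sign as S using (Sign) renaming (_*_ to _·_)
import Data.Sign.Properties as SP
open import Data.Vec using (Vec; lookup)
open import Data.Vec.Properties using (lookup∘tabulate)
open import Function using (_∘_)
open import Relation.Nullary using (yes; no)
open import Relation.Nullary.Negation using (contradiction)
open import Relation.Binary.PropositionalEquality
  using (_≡_; _≢_; refl; sym; trans; cong; cong₂; subst; subst₂; module ≡-Reasoning)

open import Defs

module RangeFold {c ℓ} (M : CommutativeMonoid c ℓ) where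
  open CommutativeMonoid M
    renaming (Carrier to X; refl to ≈-refl; sym to ≈-sym; trans to ≈-trans)
  open import Algebra.Properties.CommutativeSemigroup commutativeSemigroup using (interchange)
  open import Algebra.Solver.CommutativeMonoid M using (solve; _⊜_; _⊕_)
  open import Relation.Binary.Reasoning.Setoid setoid

  fold< : ℕ → (ℕ → X) → X
  fold< zero    f = ε
  fold< (suc L) f = f 0 ∙ fold< L (f ∘ suc)

  fold<-cong : ∀ L {f g : ℕ → X} → (∀ j → j < L → f j ≈ g j) → fold< L f ≈ fold< L g
  fold<-cong zero    f≈g = ≈-refl
  fold<-cong (suc L) f≈g = ∙-cong (f≈g 0 (s≤s z≤n)) (fold<-cong L (λ j j<L → f≈g (suc j) (s≤s j<L)))

  fold<-identity : ∀ L {f : ℕ → X} → (∀ j → j < L → f j ≈ ε) → fold< L f ≈ ε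
  fold<-identity zero    f≈ε = ≈-refl
  fold<-identity (suc L) f≈ε =
    ≈-trans (∙-cong (f≈ε 0 (s≤s z≤n)) (fold<-identity L (λ j j<L → f≈ε (suc j) (s≤s j<L))))
            (identityˡ ε)

  fold<-snoc : ∀ L (f : ℕ → X) → fold< (suc L) f ≈ fold< L f ∙ f L
  fold<-snoc zero    f = ≈-trans (identityʳ (f 0)) (≈-sym (identityˡ (f 0)))
  fold<-snoc (suc L) f = ≈-trans (∙-congˡ (fold<-snoc L (f ∘ suc))) (≈-sym (assoc _ _ _))

  fold<-distrib : ∀ L (f g : ℕ → X) → fold< L (λ j → f j ∙ g j) ≈ fold< L f ∙ fold< L g
  fold<-distrib zero    f g = ≈-sym (identityˡ ε)
  fold<-distrib (suc L) f g =
    ≈-trans (∙-congˡ (fold<-distrib L (f ∘ suc) (g ∘ suc))) (interchange _ _ _ _)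

  fold<-reverse : ∀ L (f : ℕ → X) → fold< L f ≈ fold< L (λ j → f (L ∸ suc j))
  fold<-reverse zero    f = ≈-refl
  fold<-reverse (suc L) f = begin
    f 0 ∙ fold< L (f ∘ suc)                        ≈⟨ ∙-congˡ (fold<-reverse L (f ∘ suc)) ⟩
    f 0 ∙ fold< L (λ j → f (suc (L ∸ suc j)))      ≈⟨ ∙-congˡ (fold<-cong L (λ j j<L →
                                                        reflexive (cong f (sym (ℕP.+-∸-assoc 1 j<L))))) ⟩
    f 0 ∙ fold< L (λ j → f (suc L ∸ suc j))        ≈⟨ comm _ _ ⟩
    fold< L (λ j → f (suc L ∸ suc j)) ∙ f 0        ≡⟨ cong (λ k → fold< L (λ j → f (suc L ∸ suc j)) ∙ f k)
                                                           (sym (ℕP.n∸n≡0 L)) ⟩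
    fold< L (λ j → f (suc L ∸ suc j)) ∙ f (L ∸ L)  ≈⟨ fold<-snoc L _ ⟨
    fold< (suc L) (λ j → f (suc L ∸ suc j))        ∎

  fold<-take : ∀ {w L} (f : ℕ → X) → w ≤ L → (∀ j → w ≤ j → f j ≈ ε) → fold< L f ≈ fold< w f
  fold<-take {zero}  {L}     f _         f≈ε = fold<-identity L (λ j _ → f≈ε j z≤n)
  fold<-take {suc w} {suc L} f (s≤s w≤L) f≈ε =
    ∙-congˡ (fold<-take (f ∘ suc) w≤L (λ j w≤j → f≈ε (suc j) (s≤s w≤j)))

  fold<-drop : ∀ s L (f : ℕ → X) → (∀ j → j < s → f j ≈ ε) →
               fold< L f ≈ fold< (L ∸ s) (λ j → f (s ℕ.+ j))
  fold<-drop zero    L       f f≈ε = ≈-refl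
  fold<-drop (suc s) zero    f f≈ε = ≈-refl
  fold<-drop (suc s) (suc L) f f≈ε =
    ≈-trans (∙-cong (f≈ε 0 (s≤s z≤n)) (fold<-drop s L (f ∘ suc) (λ j j<s → f≈ε (suc j) (s≤s j<s))))
            (identityˡ _)

  fold<-lag-step : ∀ L s (x : ℕ → X) →
    fold< (suc L) (λ j → x j ∙ x (j ℕ.+ s)) ≈ fold< L (λ j → x j ∙ x (j ℕ.+ suc s)) ∙ (x s ∙ x L)
  fold<-lag-step L s x = begin
    fold< (suc L) (λ j → x j ∙ x (j ℕ.+ s))
      ≈⟨ fold<-distrib (suc L) x (λ j → x (j ℕ.+ s)) ⟩
    fold< (suc L) x ∙ (x s ∙ fold< L (λ j → x (suc (j ℕ.+ s))))
      ≈⟨ ∙-cong (fold<-snoc L x) (∙-congˡ (fold<-cong L (λ j _ → reflexive (cong x (sym (ℕP.+-suc j s)))))) ⟩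
    (fold< L x ∙ x L) ∙ (x s ∙ fold< L (λ j → x (j ℕ.+ suc s)))
      ≈⟨ solve 4 (λ P a b Q → ((P ⊕ a) ⊕ (b ⊕ Q)) ⊜ ((P ⊕ Q) ⊕ (b ⊕ a))) ≈-refl _ _ _ _ ⟩
    (fold< L x ∙ fold< L (λ j → x (j ℕ.+ suc s))) ∙ (x s ∙ x L)
      ≈⟨ ∙-congʳ (fold<-distrib L x _) ⟨
    fold< L (λ j → x j ∙ x (j ℕ.+ suc s)) ∙ (x s ∙ x L)
      ∎

module ∑ = RangeFold ℤP.+-0-commutativeMonoid
module ∏ = RangeFold SP.*-commutativeMonoid

double≡0⇒≡0 : ∀ x → x + x ≡ 0ℤ → x ≡ 0ℤ
double≡0⇒≡0 (+ zero)   _  = refl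
double≡0⇒≡0 (+ suc n)  ()
double≡0⇒≡0 -[1+ n ]   ()

∑-antisymmetric : ∀ w (f : ℕ → ℤ) → (∀ l → l < w → f l + f (w ∸ suc l) ≡ 0ℤ) → ∑.fold< w f ≡ 0ℤ
∑-antisymmetric w f pair = double≡0⇒≡0 total (begin
  total + total                            ≡⟨ cong (_+_ total) (∑.fold<-reverse w f) ⟩
  total + ∑.fold< w (λ l → f (w ∸ suc l))  ≡⟨ ∑.fold<-distrib w f _ ⟨
  ∑.fold< w (λ l → f l + f (w ∸ suc l))   ≡⟨ ∑.fold<-identity w pair ⟩
  0ℤ                                       ∎)
  where
  open ≡-Reasoning
  total = ∑.fold< w f

sumℤ-applyUpTo : ∀ L (f : ℕ → ℤ) (g : ℕ → ℕ) → sumℤ (map f (applyUpTo g L)) ≡ ∑.fold< L (f ∘ g)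
sumℤ-applyUpTo zero    f g = refl
sumℤ-applyUpTo (suc L) f g = cong (_+_ (f (g 0))) (sumℤ-applyUpTo L f (g ∘ suc))

val-· : ∀ s t → val (s · t) ≡ val s * val t
val-· S.+ S.+ = refl
val-· S.+ S.- = refl
val-· S.- S.+ = refl
val-· S.- S.- = refl

val-opposite : ∀ s → val (S.opposite s) ≡ - val s
val-opposite S.+ = refl
val-opposite S.- = refl

atℕ : {k : ℕ} → Vec Sign k → ℕ → ℤ
atℕ X j = at X (+ suc j)

-- Outside the sequence the sign is the junk value +.
signAt : {k : ℕ} → Vec Sign k → ℕ → Sign
signAt {k} X j with j <? k
... | yes j<k = lookup X (fromℕ< j<k)
... | no  _   = S.+

atℕ-in : {k : ℕ} (X : Vec Sign k) {j : ℕ} → j < k → atℕ X j ≡ val (signAt X j)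
atℕ-in {k} X {j} j<k with j <? k
... | yes _   = refl
... | no  j≮k = contradiction j<k j≮k

atℕ-out : {k : ℕ} (X : Vec Sign k) {j : ℕ} → k ≤ j → atℕ X j ≡ 0ℤ
atℕ-out {k} X {j} k≤j with j <? k
... | yes j<k = contradiction j<k (ℕP.≤⇒≯ k≤j)
... | no  _   = refl

signAt-toℕ : {k : ℕ} (X : Vec Sign k) (u : Fin k) → signAt X (toℕ u) ≡ lookup X u
signAt-toℕ {k} X u with toℕ u <? k
... | yes u<k = cong (lookup X) (fromℕ<-toℕ u u<k)
... | no  u≮k = contradiction (toℕ<n u) u≮k

atℕ-toℕ : {k : ℕ} (X : Vec Sign k) (u : Fin k) → atℕ X (toℕ u) ≡ val (lookup X u)
atℕ-toℕ X u = trans (atℕ-in X (toℕ<n u)) (cong val (signAt-toℕ X u))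

<∸⇒+< : ∀ {j k s} → j < k ∸ s → j ℕ.+ s < k
<∸⇒+< {j} {k} {s} j<k∸s =
  ℕP.m≤o∸n⇒m+n≤o (suc j) s≤k j<k∸s
  where
  s≤k : s ≤ k
  s≤k = ℕP.<⇒≤ (ℕP.m∸n≢0⇒n<m (ℕP.m>n⇒m∸n≢0 (ℕP.≤-<-trans z≤n j<k∸s)))

∸≤⇒≤+ : ∀ {j k s} → k ∸ s ≤ j → k ≤ j ℕ.+ s
∸≤⇒≤+ {j} {k} {s} k∸s≤j =
  subst (k ≤_) (ℕP.+-comm s j) (ℕP.≤-trans (ℕP.m≤n+m∸n k s) (ℕP.+-monoʳ-≤ s k∸s≤j))

reflect-lag : ∀ {l} m n → l < n ∸ m →
  (n ∸ m ∸ suc l ≡ n ∸ suc (l ℕ.+ m)) × (n ∸ m ∸ suc l ℕ.+ m ≡ n ∸ suc l)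
reflect-lag {l} m n l<n∸m =
  trans (ℕP.∸-+-assoc n m (suc l)) (cong (n ∸_) m+1+l≡1+l+m) ,
  trans (cong (ℕ._+ m) (trans (ℕP.∸-+-assoc n m (suc l)) (trans (cong (n ∸_) (ℕP.+-comm m (suc l)))
                                                                (sym (ℕP.∸-+-assoc n (suc l) m)))))
        (ℕP.m∸n+n≡m (ℕP.m+n≤o⇒m≤o∸n m (subst (_≤ n) (sym m+1+l≡1+l+m) (<∸⇒+< l<n∸m))))
  where
  m+1+l≡1+l+m : m ℕ.+ suc l ≡ suc (l ℕ.+ m)
  m+1+l≡1+l+m = trans (ℕP.+-suc m l) (cong suc (ℕP.+-comm m l))

N≡∑ : {k : ℕ} (X : Vec Sign k) (i : ℤ) → N X i ≡ ∑.fold< k (λ j → atℕ X j * at X (+ suc j + i))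
N≡∑ {k} X i = sumℤ-applyUpTo k _ (λ j → j)

N≡∑-nonneg : {k : ℕ} (X : Vec Sign k) (s : ℕ) →
  N X (+ s) ≡ ∑.fold< (k ∸ s) (λ j → atℕ X j * atℕ X (j ℕ.+ s))
N≡∑-nonneg {k} X s = trans (N≡∑ X (+ s)) (∑.fold<-take _ (ℕP.m∸n≤m k s) vanishes)
  where
  vanishes : ∀ j → k ∸ s ≤ j → atℕ X j * atℕ X (j ℕ.+ s) ≡ 0ℤ
  vanishes j k∸s≤j = trans (cong (atℕ X j *_) (atℕ-out X (∸≤⇒≤+ k∸s≤j))) (ℤP.*-zeroʳ (atℕ X j))

N-even : {k : ℕ} (X : Vec Sign k) (m : ℕ) → N X -[1+ m ] ≡ N X (+ suc m)
N-even {k} X m = begin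
  N X -[1+ m ]
    ≡⟨ N≡∑ X -[1+ m ] ⟩
  ∑.fold< k term
    ≡⟨ ∑.fold<-drop (suc m) k term (λ j j≤m →
         trans (cong (atℕ X j *_) (before-start j≤m)) (ℤP.*-zeroʳ (atℕ X j))) ⟩
  ∑.fold< (k ∸ suc m) (λ l → term (suc m ℕ.+ l))
    ≡⟨ ∑.fold<-cong (k ∸ suc m) {λ l → term (suc m ℕ.+ l)} (λ l _ → swapped l) ⟩
  ∑.fold< (k ∸ suc m) (λ l → atℕ X l * atℕ X (l ℕ.+ suc m))
    ≡⟨ N≡∑-nonneg X (suc m) ⟨
  N X (+ suc m)
    ∎
  where
  open ≡-Reasoning
  term : ℕ → ℤ
  term j = atℕ X j * at X (+ suc j + -[1+ m ])
  at-nonpos : ∀ i → at X (- (+ i)) ≡ 0ℤ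
  at-nonpos zero    = refl
  at-nonpos (suc i) = refl
  before-start : ∀ {j} → j < suc m → at X (+ suc j + -[1+ m ]) ≡ 0ℤ
  before-start {j} j<sm = trans (cong (at X) (ℤP.⊖-≤ j<sm)) (at-nonpos (m ∸ j))
  shifted : ∀ l → at X (+ suc (suc m ℕ.+ l) + -[1+ m ]) ≡ atℕ X l
  shifted l = cong (at X) (trans (ℤP.⊖-≥ (s≤s (ℕP.m≤n⇒m≤1+n (ℕP.m≤m+n m l))))
    (cong +_ (trans (cong (_∸ m) (sym (ℕP.+-suc m l))) (ℕP.m+n∸m≡n m (suc l)))))
  swapped : ∀ l → term (suc m ℕ.+ l) ≡ atℕ X l * atℕ X (l ℕ.+ suc m)
  swapped l = begin
    atℕ X (suc m ℕ.+ l) * at X (+ suc (suc m ℕ.+ l) + -[1+ m ])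
      ≡⟨ cong (atℕ X (suc m ℕ.+ l) *_) (shifted l) ⟩
    atℕ X (suc m ℕ.+ l) * atℕ X l
      ≡⟨ ℤP.*-comm (atℕ X (suc m ℕ.+ l)) (atℕ X l) ⟩
    atℕ X l * atℕ X (suc m ℕ.+ l)
      ≡⟨ cong (λ j → atℕ X l * atℕ X j) (ℕP.+-comm (suc m) l) ⟩
    atℕ X l * atℕ X (l ℕ.+ suc m)
      ∎

·-cong₄ : ∀ {a b c d a′ b′ c′ d′ : Sign} → a ≡ a′ → b ≡ b′ → c ≡ c′ → d ≡ d′ →
          a · b · c · d ≡ a′ · b′ · c′ · d′
·-cong₄ refl refl refl refl = refl

parity : ℕ → Sign
parity zero    = S.+
parity (suc q) = S.- · parity q

parity-+ : ∀ p q → parity (p ℕ.+ q) ≡ parity p · parity q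
parity-+ zero    q = refl
parity-+ (suc p) q = trans (cong (S.- ·_) (parity-+ p q)) (sym (SP.*-assoc S.- (parity p) (parity q)))

parity-odd : ∀ m → parity (suc (m ℕ.+ m)) ≡ S.-
parity-odd m = cong (S.- ·_) (trans (parity-+ m m) (SP.s*s≡+ (parity m)))

-- q counts the negative signs.
sum-and-product-of-signs : ∀ L (σ : ℕ → Sign) →
  Σ[ q ∈ ℕ ] (+ L ≡ ∑.fold< L (val ∘ σ) + (+ q + + q)) × ∏.fold< L σ ≡ parity q
sum-and-product-of-signs zero    σ = 0 , refl , refl
sum-and-product-of-signs (suc L) σ with σ 0 | sum-and-product-of-signs L (σ ∘ suc)
... | S.+ | q , sum≡ , prod≡ =
  q , trans (cong (_+_ 1ℤ) sum≡) (sym (ℤP.+-assoc 1ℤ (∑.fold< L (val ∘ σ ∘ suc)) (+ q + + q))) , prod≡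
... | S.- | q , sum≡ , prod≡ =
  suc q , trans (cong (_+_ 1ℤ) sum≡) (regroup (∑.fold< L (val ∘ σ ∘ suc)) (+ q)) , cong (S.- ·_) prod≡
  where
  regroup : ∀ s q → 1ℤ + (s + (q + q)) ≡ (-1ℤ + s) + ((1ℤ + q) + (1ℤ + q))
  regroup = solve-∀

lagTerm : {k : ℕ} → Vec Sign k → ℕ → ℕ → Sign
lagTerm X s j = signAt X j · signAt X (j ℕ.+ s)

lagProduct : {k : ℕ} → Vec Sign k → ℕ → Sign
lagProduct {k} X s = ∏.fold< (k ∸ s) (lagTerm X s)

N≡∑lagTerm : {k : ℕ} (X : Vec Sign k) (s : ℕ) →
  N X (+ s) ≡ ∑.fold< (k ∸ s) (val ∘ lagTerm X s)
N≡∑lagTerm {k} X s = trans (N≡∑-nonneg X s) (∑.fold<-cong (k ∸ s) λ j j<k∸s → begin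
  atℕ X j * atℕ X (j ℕ.+ s)
    ≡⟨ cong₂ _*_ (atℕ-in X (ℕP.<-≤-trans j<k∸s (ℕP.m∸n≤m k s))) (atℕ-in X (<∸⇒+< j<k∸s)) ⟩
  val (signAt X j) * val (signAt X (j ℕ.+ s))
    ≡⟨ val-· (signAt X j) _ ⟨
  val (signAt X j · signAt X (j ℕ.+ s))
    ∎)
  where open ≡-Reasoning

lagProduct-zero : {k : ℕ} (X : Vec Sign k) → lagProduct X 0 ≡ S.+
lagProduct-zero {k} X = ∏.fold<-identity k (λ j _ →
  trans (cong (λ i → signAt X j · signAt X i) (ℕP.+-identityʳ j)) (SP.s*s≡+ (signAt X j)))

lagProduct-length : {k : ℕ} (X : Vec Sign k) → lagProduct X k ≡ S.+
lagProduct-length {k} X = cong (λ L → ∏.fold< L (lagTerm X k)) (ℕP.n∸n≡0 k)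

lagProduct-last : {k : ℕ} (X : Vec Sign (suc k)) → lagProduct X k ≡ signAt X 0 · signAt X k
lagProduct-last {k} X =
  trans (cong (λ L → ∏.fold< L (lagTerm X k)) (ℕP.m+n∸n≡m 1 k)) (SP.*-identityʳ (signAt X 0 · signAt X k))

lagProduct-step : {k : ℕ} (X : Vec Sign k) {s : ℕ} → s < k →
  lagProduct X s ≡ lagProduct X (suc s) · (signAt X s · signAt X (k ∸ suc s))
lagProduct-step {k} X {s} s<k =
  trans (cong (λ L → ∏.fold< L (lagTerm X s)) (ℕP.+-∸-assoc 1 s<k)) (∏.fold<-lag-step (k ∸ suc s) s (signAt X))

+-double-injective : ∀ p q → p ℕ.+ p ≡ q ℕ.+ q → p ≡ q
+-double-injective zero    zero    _  = refl
+-double-injective (suc p) (suc q) eq = cong suc (+-double-injective p q (ℕP.suc-injective (begin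
  suc (p ℕ.+ p) ≡⟨ ℕP.+-suc p p ⟨
  p ℕ.+ suc p   ≡⟨ ℕP.suc-injective eq ⟩
  q ℕ.+ suc q   ≡⟨ ℕP.+-suc q q ⟩
  suc (q ℕ.+ q) ∎)))
  where open ≡-Reasoning

-- Each lag product is (-1)^(number of negative terms); the vanishing of the summed
-- autocorrelations forces the total number of negative terms to be 2(n - s) + 1.
lagProducts-of-BS : (n : ℕ) (A B : Vec Sign (suc n)) (C D : Vec Sign n) → IsBS n A B C D →
  ∀ {s} → 0 < s → s ≤ n → lagProduct A s · lagProduct B s · lagProduct C s · lagProduct D s ≡ S.-
lagProducts-of-BS n A B C D bs {s} 0<s s≤n
  with sum-and-product-of-signs (suc n ∸ s) (lagTerm A s) | sum-and-product-of-signs (suc n ∸ s) (lagTerm B s)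
     | sum-and-product-of-signs (n ∸ s) (lagTerm C s)     | sum-and-product-of-signs (n ∸ s) (lagTerm D s)
... | qA , sumA , prodA | qB , sumB , prodB | qC , sumC , prodC | qD , sumD , prodD = begin
  lagProduct A s · lagProduct B s · lagProduct C s · lagProduct D s
    ≡⟨ ·-cong₄ prodA prodB prodC prodD ⟩
  parity qA · parity qB · parity qC · parity qD
    ≡⟨ trans (parity-+ (qA ℕ.+ qB ℕ.+ qC) qD)
             (cong (_· parity qD) (trans (parity-+ (qA ℕ.+ qB) qC) (cong (_· parity qC) (parity-+ qA qB)))) ⟨
  parity (qA ℕ.+ qB ℕ.+ qC ℕ.+ qD)
    ≡⟨ cong parity negatives-odd ⟩
  parity (suc (m ℕ.+ m))
    ≡⟨ parity-odd m ⟩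
  S.-
    ∎
  where
  open ≡-Reasoning
  m = n ∸ s
  Q = qA ℕ.+ qB ℕ.+ qC ℕ.+ qD
  lagSum : {k : ℕ} → Vec Sign k → ℤ
  lagSum {k} X = ∑.fold< (k ∸ s) (val ∘ lagTerm X s)
  autocorrelations-vanish : lagSum A + lagSum B + lagSum C + lagSum D ≡ 0ℤ
  autocorrelations-vanish = begin
    lagSum A + lagSum B + lagSum C + lagSum D
      ≡⟨ cong₂ _+_ (cong₂ _+_ (cong₂ _+_ (N≡∑lagTerm A s) (N≡∑lagTerm B s)) (N≡∑lagTerm C s)) (N≡∑lagTerm D s) ⟨
    N A (+ s) + N B (+ s) + N C (+ s) + N D (+ s)
      ≡⟨ bs (+ s) (λ s≡0 → ℕP.<⇒≢ 0<s (sym (ℤP.+-injective s≡0))) ⟩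
    0ℤ
      ∎
  regroup : ∀ x y z w qx qy qz qw →
    (x + (qx + qx)) + (y + (qy + qy)) + (z + (qz + qz)) + (w + (qw + qw))
      ≡ (x + y + z + w) + ((qx + qy + qz + qw) + (qx + qy + qz + qw))
  regroup = solve-∀
  lengths : Q ℕ.+ Q ≡ (suc n ∸ s) ℕ.+ (suc n ∸ s) ℕ.+ m ℕ.+ m
  lengths = ℤP.+-injective (sym (begin
    + (suc n ∸ s) + + (suc n ∸ s) + + m + + m
      ≡⟨ cong₂ _+_ (cong₂ _+_ (cong₂ _+_ sumA sumB) sumC) sumD ⟩
    (lagSum A + (+ qA + + qA)) + (lagSum B + (+ qB + + qB)) + (lagSum C + (+ qC + + qC)) + (lagSum D + (+ qD + + qD))
      ≡⟨ regroup (lagSum A) (lagSum B) (lagSum C) (lagSum D) (+ qA) (+ qB) (+ qC) (+ qD) ⟩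
    (lagSum A + lagSum B + lagSum C + lagSum D) + + (Q ℕ.+ Q)
      ≡⟨ cong (_+ + (Q ℕ.+ Q)) autocorrelations-vanish ⟩
    + (Q ℕ.+ Q)
      ∎))
  odd-total : ∀ m → suc m ℕ.+ suc m ℕ.+ m ℕ.+ m ≡ suc (m ℕ.+ m) ℕ.+ suc (m ℕ.+ m)
  odd-total = ℕ-Solver.solve-∀
  negatives-odd : Q ≡ suc (m ℕ.+ m)
  negatives-odd = +-double-injective Q (suc (m ℕ.+ m))
    (trans lengths (trans (cong (λ L → L ℕ.+ L ℕ.+ m ℕ.+ m) (ℕP.+-∸-assoc 1 s≤n)) (odd-total m)))

-- The four entries of a quad sum to 0 (mod 4) exactly when their product is +.
quadProduct : {n : ℕ} → Vec Sign n → Vec Sign n → Fin n → Sign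
quadProduct C D p = (lookup C p · lookup C (Fin.opposite p)) · (lookup D p · lookup D (Fin.opposite p))

module QuadsOfBS {n : ℕ} (A B : Vec Sign (suc n)) (C D : Vec Sign n) (bs : IsBS n A B C D) where
  open import Algebra.Solver.CommutativeMonoid SP.*-commutativeMonoid using (solve; _⊜_; _⊕_)
  open ≡-Reasoning

  a b c d : ℕ → Sign
  a = signAt A
  b = signAt B
  c = signAt C
  d = signAt D

  P : ℕ → Sign
  P s = lagProduct A s · lagProduct B s · lagProduct C s · lagProduct D s

  -- W s and V s are the products over the s-th quads (0-based) of (A;B) and of (C;D).
  W V : ℕ → Sign
  W s = (a s · a (n ∸ s)) · (b s · b (n ∸ s))
  V s = (c s · c (n ∸ suc s)) · (d s · d (n ∸ suc s))

  P-step : ∀ {s} → s < n → P s ≡ P (suc s) · (W s · V s)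
  P-step {s} s<n = trans
    (·-cong₄ (lagProduct-step A (ℕP.m≤n⇒m≤1+n s<n)) (lagProduct-step B (ℕP.m≤n⇒m≤1+n s<n))
             (lagProduct-step C s<n) (lagProduct-step D s<n))
    (regroup (lagProduct A (suc s)) (lagProduct B (suc s)) (lagProduct C (suc s)) (lagProduct D (suc s)) _ _ _ _)
    where
    regroup : ∀ pa pb pc pd wa wb vc vd →
      (pa · wa) · (pb · wb) · (pc · vc) · (pd · vd) ≡ (pa · pb · pc · pd) · ((wa · wb) · (vc · vd))
    regroup = solve 8 (λ pa pb pc pd wa wb vc vd →
      ((((pa ⊕ wa) ⊕ (pb ⊕ wb)) ⊕ (pc ⊕ vc)) ⊕ (pd ⊕ vd))
        ⊜ ((((pa ⊕ pb) ⊕ pc) ⊕ pd) ⊕ ((wa ⊕ wb) ⊕ (vc ⊕ vd)))) refl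

  P-zero : P 0 ≡ S.+
  P-zero = ·-cong₄ (lagProduct-zero A) (lagProduct-zero B) (lagProduct-zero C) (lagProduct-zero D)

  P-inner : ∀ {s} → 0 < s → s ≤ n → P s ≡ S.-
  P-inner = lagProducts-of-BS n A B C D bs

  W-first : 0 < n → W 0 ≡ S.-
  W-first 0<n = begin
    W 0              ≡⟨ SP.*-identityʳ (W 0) ⟨
    W 0 · S.+        ≡⟨ SP.*-identityʳ (W 0 · S.+) ⟨
    W 0 · S.+ · S.+  ≡⟨ ·-cong₄ (lagProduct-last A) (lagProduct-last B) (lagProduct-length C) (lagProduct-length D) ⟨
    P n              ≡⟨ P-inner 0<n ℕP.≤-refl ⟩
    S.-              ∎

  WV-first : 0 < n → W 0 · V 0 ≡ S.-
  WV-first 0<n = SP.*-cancelˡ-≡ S.- (W 0 · V 0) S.- (begin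
    S.- · (W 0 · V 0)    ≡⟨ cong (_· (W 0 · V 0)) (P-inner (s≤s z≤n) 0<n) ⟨
    P 1 · (W 0 · V 0)    ≡⟨ P-step 0<n ⟨
    P 0                  ≡⟨ P-zero ⟩
    S.+                  ∎)

  WV-inner : ∀ {s} → 0 < s → suc s ≤ n → W s · V s ≡ S.+
  WV-inner {s} 0<s s<n = SP.*-cancelˡ-≡ S.- (W s · V s) S.+ (begin
    S.- · (W s · V s)        ≡⟨ cong (_· (W s · V s)) (P-inner (s≤s z≤n) s<n) ⟨
    P (suc s) · (W s · V s)  ≡⟨ P-step s<n ⟨
    P s                      ≡⟨ P-inner 0<s (ℕP.<⇒≤ s<n) ⟩
    S.-                      ∎)

  W-reflect : ∀ {s} → s ≤ n → W (n ∸ s) ≡ W s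
  W-reflect {s} s≤n = trans (cong (λ i → (a (n ∸ s) · a i) · (b (n ∸ s) · b i)) (ℕP.m∸[m∸n]≡n s≤n))
    (cong₂ _·_ (SP.*-comm (a (n ∸ s)) (a s)) (SP.*-comm (b (n ∸ s)) (b s)))

  V-reflect : ∀ {s} → s < n → V (n ∸ suc s) ≡ V s
  V-reflect {s} s<n = trans (cong (λ i → (c (n ∸ suc s) · c i) · (d (n ∸ suc s) · d i)) reflect-index)
    (cong₂ _·_ (SP.*-comm (c (n ∸ suc s)) (c s)) (SP.*-comm (d (n ∸ suc s)) (d s)))
    where
    reflect-index : n ∸ suc (n ∸ suc s) ≡ s
    reflect-index = trans (sym (ℕP.pred[m∸n]≡m∸[1+n] n (n ∸ suc s))) (cong ℕ.pred (ℕP.m∸[m∸n]≡n s<n))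

  V≡+ : ∀ r → r < n → V r ≡ S.+
  V≡+ zero    0<n  = SP.*-cancelˡ-≡ S.- (V 0) S.+ (trans (cong (_· V 0) (sym (W-first 0<n))) (WV-first 0<n))
  V≡+ (suc r) sr<n = trans (SP.*-cancelˡ-≡ (W (suc r)) (V (suc r)) (V r) (trans inner (sym mirror)))
                           (V≡+ r (ℕP.<-trans (ℕP.n<1+n r) sr<n))
    where
    inner : W (suc r) · V (suc r) ≡ S.+
    inner = WV-inner (s≤s z≤n) sr<n
    -- W (r + 1) · V r = W t · V t for the mirror index t = n - r - 1.
    mirror : W (suc r) · V r ≡ S.+
    mirror = begin
      W (suc r) · V r
        ≡⟨ cong₂ _·_ (W-reflect (ℕP.<⇒≤ sr<n)) (V-reflect (ℕP.<-trans (ℕP.n<1+n r) sr<n)) ⟨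
      W (n ∸ suc r) · V (n ∸ suc r)
        ≡⟨ WV-inner (ℕP.m<n⇒0<n∸m sr<n) (ℕP.∸-monoʳ-< (s≤s z≤n) (ℕP.<⇒≤ sr<n)) ⟩
      S.+
        ∎

  quadProduct≡+ : ∀ p → quadProduct C D p ≡ S.+
  quadProduct≡+ p = begin
    quadProduct C D p
      ≡⟨ cong₂ _·_ (cong₂ _·_ (signAt-toℕ C p) (mirror C)) (cong₂ _·_ (signAt-toℕ D p) (mirror D)) ⟨
    V (toℕ p)
      ≡⟨ V≡+ (toℕ p) (toℕ<n p) ⟩
    S.+
      ∎
    where
    mirror : ∀ X → signAt X (n ∸ suc (toℕ p)) ≡ lookup X (Fin.opposite p)
    mirror X = trans (cong (signAt X) (sym (opposite-prop p))) (signAt-toℕ X (Fin.opposite p))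

isLabel45-shape : ∀ x x′ y y′ → isLabel45 x x′ y y′ ≡ true →
                  x′ ≡ S.opposite x × y ≡ S.opposite x × y′ ≡ x
isLabel45-shape S.+ S.+ _   _   ()
isLabel45-shape S.+ S.- S.+ _   ()
isLabel45-shape S.+ S.- S.- S.+ _ = refl , refl , refl
isLabel45-shape S.+ S.- S.- S.- ()
isLabel45-shape S.- S.- _   _   ()
isLabel45-shape S.- S.+ S.- _   ()
isLabel45-shape S.- S.+ S.+ S.+ ()
isLabel45-shape S.- S.+ S.+ S.- _ = refl , refl , refl

non45-balanced : ∀ x x′ y y′ → (x · x′) · (y · y′) ≡ S.+ → isLabel45 x x′ y y′ ≡ false →
                 val x - val y ≡ val x′ - val y′
non45-balanced S.+ S.+ S.+ S.+ _  _  = refl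
non45-balanced S.+ S.+ S.+ S.- () _
non45-balanced S.+ S.+ S.- S.+ () _
non45-balanced S.+ S.+ S.- S.- _  _  = refl
non45-balanced S.+ S.- S.+ S.+ () _
non45-balanced S.+ S.- S.+ S.- _  _  = refl
non45-balanced S.+ S.- S.- S.+ _  ()
non45-balanced S.+ S.- S.- S.- () _
non45-balanced S.- S.+ S.+ S.+ () _
non45-balanced S.- S.+ S.+ S.- _  ()
non45-balanced S.- S.+ S.- S.+ _  _  = refl
non45-balanced S.- S.+ S.- S.- () _
non45-balanced S.- S.- S.+ S.+ _  _  = refl
non45-balanced S.- S.- S.+ S.- () _
non45-balanced S.- S.- S.- S.+ () _
non45-balanced S.- S.- S.- S.- _  _  = refl

isLabel45-swap : ∀ x x′ y y′ → isLabel45 x′ x y′ y ≡ isLabel45 x x′ y y′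
isLabel45-swap S.+ S.+ _   _   = refl
isLabel45-swap S.- S.- _   _   = refl
isLabel45-swap S.+ S.- S.+ S.+ = refl
isLabel45-swap S.+ S.- S.+ S.- = refl
isLabel45-swap S.+ S.- S.- S.+ = refl
isLabel45-swap S.+ S.- S.- S.- = refl
isLabel45-swap S.- S.+ S.+ S.+ = refl
isLabel45-swap S.- S.+ S.+ S.- = refl
isLabel45-swap S.- S.+ S.- S.+ = refl
isLabel45-swap S.- S.+ S.- S.- = refl

isLabel45-diagonal : ∀ x y → isLabel45 x x y y ≡ false
isLabel45-diagonal S.+ _ = refl
isLabel45-diagonal S.- _ = refl

-- In a quad of label 4 or 5 the difference c - d flips sign between the two columns;
-- in every other quad with product + it is the same in both.
cross-term-vanishes : ∀ x x′ y y′ z z′ w w′ → isLabel45 x x′ y y′ ≡ true →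
  (z · z′) · (w · w′) ≡ S.+ → isLabel45 z z′ w w′ ≡ false →
  (val x * val z + val y * val w) + (val x′ * val z′ + val y′ * val w′) ≡ 0ℤ
cross-term-vanishes x x′ y y′ z z′ w w′ label45 product+ non45
  with isLabel45-shape x x′ y y′ label45
... | refl , refl , refl = begin
  (val x * val z + val (S.opposite x) * val w) + (val (S.opposite x) * val z′ + val x * val w′)
    ≡⟨ cong (λ t → (val x * val z + t * val w) + (t * val z′ + val x * val w′)) (val-opposite x) ⟩
  (val x * val z + - val x * val w) + (- val x * val z′ + val x * val w′)
    ≡⟨ factor (val x) (val z) (val w) (val z′) (val w′) ⟩
  val x * ((val z - val w) - (val z′ - val w′))
    ≡⟨ cong (λ t → val x * (t - (val z′ - val w′))) (non45-balanced z z′ w w′ product+ non45) ⟩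
  val x * ((val z′ - val w′) - (val z′ - val w′))
    ≡⟨ cong (val x *_) (ℤP.+-inverseʳ (val z′ - val w′)) ⟩
  val x * 0ℤ
    ≡⟨ ℤP.*-zeroʳ (val x) ⟩
  0ℤ ∎
  where
  open ≡-Reasoning
  factor : ∀ x z w z′ w′ → (x * z + - x * w) + (- x * z′ + x * w′) ≡ x * ((z - w) - (z′ - w′))
  factor = solve-∀

inQuad45≡isLabel45 : {n : ℕ} (C D : Vec Sign n) (p : Fin n) →
  inQuad45 C D p ≡ isLabel45 (lookup C p) (lookup C (Fin.opposite p)) (lookup D p) (lookup D (Fin.opposite p))
inQuad45≡isLabel45 C D p with toℕ p <? toℕ (Fin.opposite p)
... | yes _ = refl
... | no p≮p′ with toℕ (Fin.opposite p) <? toℕ p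
...   | yes _    = isLabel45-swap (lookup C p) (lookup C (Fin.opposite p)) (lookup D p) (lookup D (Fin.opposite p))
...   | no p′≮p = sym (trans (cong (λ q → isLabel45 (lookup C p) (lookup C q) (lookup D p) (lookup D q)) central)
                             (isLabel45-diagonal (lookup C p) (lookup D p)))
  where
  central : Fin.opposite p ≡ p
  central = FinP.toℕ-injective (ℕP.≤-antisym (ℕP.≮⇒≥ p≮p′) (ℕP.≮⇒≥ p′≮p))

inQuad45-opposite : {n : ℕ} (C D : Vec Sign n) (p : Fin n) → inQuad45 C D (Fin.opposite p) ≡ inQuad45 C D p
inQuad45-opposite C D p = begin
  inQuad45 C D (Fin.opposite p)
    ≡⟨ inQuad45≡isLabel45 C D (Fin.opposite p) ⟩
  isLabel45 (lookup C (Fin.opposite p)) (lookup C (Fin.opposite (Fin.opposite p)))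
            (lookup D (Fin.opposite p)) (lookup D (Fin.opposite (Fin.opposite p)))
    ≡⟨ cong (λ q → isLabel45 (lookup C (Fin.opposite p)) (lookup C q) (lookup D (Fin.opposite p)) (lookup D q))
            (opposite-involutive p) ⟩
  isLabel45 (lookup C (Fin.opposite p)) (lookup C p) (lookup D (Fin.opposite p)) (lookup D p)
    ≡⟨ isLabel45-swap (lookup C p) (lookup C (Fin.opposite p)) (lookup D p) (lookup D (Fin.opposite p)) ⟩
  isLabel45 (lookup C p) (lookup C (Fin.opposite p)) (lookup D p) (lookup D (Fin.opposite p))
    ≡⟨ inQuad45≡isLabel45 C D p ⟨
  inQuad45 C D p
    ∎
  where open ≡-Reasoning

flipIf : Bool → Sign → Sign
flipIf b s = if b then S.opposite s else s

flipFactor : Bool → ℤ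
flipFactor true  = -1ℤ
flipFactor false = 1ℤ

val-flipIf : ∀ b s → val (flipIf b s) ≡ flipFactor b * val s
val-flipIf true  S.+ = refl
val-flipIf true  S.- = refl
val-flipIf false S.+ = refl
val-flipIf false S.- = refl

flipFactor-vanishes : ∀ e f {x : ℤ} → (e ≢ f → x ≡ 0ℤ) → (flipFactor e * flipFactor f - 1ℤ) * x ≡ 0ℤ
flipFactor-vanishes true  true  {x} _   = ℤP.*-zeroˡ x
flipFactor-vanishes false false {x} _   = ℤP.*-zeroˡ x
flipFactor-vanishes true  false x≡0 = trans (cong (-[1+ 1 ] *_) (x≡0 (λ ()))) (ℤP.*-zeroʳ -[1+ 1 ])
flipFactor-vanishes false true  x≡0 = trans (cong (-[1+ 1 ] *_) (x≡0 (λ ()))) (ℤP.*-zeroʳ -[1+ 1 ])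

correlationTerm : {n : ℕ} → Vec Sign n → Vec Sign n → ℕ → ℕ → ℤ
correlationTerm X Y j k = atℕ X j * atℕ X k + atℕ Y j * atℕ Y k

N+N≡∑ : {n : ℕ} (X Y : Vec Sign n) (m : ℕ) →
  N X (+ m) + N Y (+ m) ≡ ∑.fold< n (λ j → correlationTerm X Y j (j ℕ.+ m))
N+N≡∑ {n} X Y m = trans (cong₂ _+_ (N≡∑ X (+ m)) (N≡∑ Y (+ m))) (sym (∑.fold<-distrib n _ _))

module Swap45 {n : ℕ} (C D : Vec Sign n) (quadProduct≡+ : ∀ p → quadProduct C D p ≡ S.+) where
  open ≡-Reasoning

  σ : Fin n → ℤ
  σ p = flipFactor (inQuad45 C D p)

  cv dv : Fin n → ℤ
  cv p = val (lookup C p)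
  dv p = val (lookup D p)

  Δ : ℕ → ℕ → ℤ
  Δ j k = correlationTerm (C̃ C D) (D̃ C D) j k - correlationTerm C D j k

  atℕ-swap45 : ∀ X u → atℕ (swap45 C D X) (toℕ u) ≡ σ u * val (lookup X u)
  atℕ-swap45 X u =
    trans (atℕ-toℕ (swap45 C D X) u)
          (trans (cong val (lookup∘tabulate _ u)) (val-flipIf (inQuad45 C D u) (lookup X u)))

  Δ-toℕ : ∀ u v → Δ (toℕ u) (toℕ v) ≡ (σ u * σ v - 1ℤ) * (cv u * cv v + dv u * dv v)
  Δ-toℕ u v
    rewrite atℕ-swap45 C u | atℕ-swap45 C v | atℕ-swap45 D u | atℕ-swap45 D v
          | atℕ-toℕ C u | atℕ-toℕ C v | atℕ-toℕ D u | atℕ-toℕ D v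
    = scale (σ u) (σ v) (cv u) (cv v) (dv u) (dv v)
    where
    scale : ∀ s t x y z w →
      ((s * x) * (t * y) + (s * z) * (t * w)) - (x * y + z * w) ≡ (s * t - 1ℤ) * (x * y + z * w)
    scale = solve-∀

  cross : Fin n → Fin n → ℤ
  cross u v = (cv u * cv v + dv u * dv v)
            + (cv (Fin.opposite u) * cv (Fin.opposite v) + dv (Fin.opposite u) * dv (Fin.opposite v))

  cross-comm : ∀ u v → cross u v ≡ cross v u
  cross-comm u v = swap (cv u) (cv v) (dv u) (dv v)
                        (cv (Fin.opposite u)) (cv (Fin.opposite v)) (dv (Fin.opposite u)) (dv (Fin.opposite v))
    where
    swap : ∀ a b c d a′ b′ c′ d′ →
      (a * b + c * d) + (a′ * b′ + c′ * d′) ≡ (b * a + d * c) + (b′ * a′ + d′ * c′)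
    swap = solve-∀

  cross-45-non45 : ∀ u v → inQuad45 C D u ≡ true → inQuad45 C D v ≡ false → cross u v ≡ 0ℤ
  cross-45-non45 u v u∈ v∉ = cross-term-vanishes
    (lookup C u) (lookup C (Fin.opposite u)) (lookup D u) (lookup D (Fin.opposite u))
    (lookup C v) (lookup C (Fin.opposite v)) (lookup D v) (lookup D (Fin.opposite v))
    (trans (sym (inQuad45≡isLabel45 C D u)) u∈) (quadProduct≡+ v) (trans (sym (inQuad45≡isLabel45 C D v)) v∉)

  cross-vanishes : ∀ u v → inQuad45 C D u ≢ inQuad45 C D v → cross u v ≡ 0ℤ
  cross-vanishes u v u≢v with inQuad45 C D u in u∈ | inQuad45 C D v in v∈
  ... | true  | true  = contradiction refl u≢v
  ... | false | false = contradiction refl u≢v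
  ... | true  | false = cross-45-non45 u v u∈ v∈
  ... | false | true  = trans (cross-comm u v) (cross-45-non45 v u v∈ u∈)

  Δ-pair-opposite : ∀ u v → Δ (toℕ u) (toℕ v) + Δ (toℕ (Fin.opposite v)) (toℕ (Fin.opposite u)) ≡ 0ℤ
  Δ-pair-opposite u v = begin
    Δ (toℕ u) (toℕ v) + Δ (toℕ v′) (toℕ u′)
      ≡⟨ cong₂ _+_ (Δ-toℕ u v) (Δ-toℕ v′ u′) ⟩
    (σ u * σ v - 1ℤ) * X + (σ v′ * σ u′ - 1ℤ) * Y
      ≡⟨ cong₂ (λ s t → (σ u * σ v - 1ℤ) * X + (s * t - 1ℤ) * Y)
               (cong flipFactor (inQuad45-opposite C D v)) (cong flipFactor (inQuad45-opposite C D u)) ⟩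
    (σ u * σ v - 1ℤ) * X + (σ v * σ u - 1ℤ) * Y
      ≡⟨ factor (σ u) (σ v) (cv u) (cv v) (dv u) (dv v) (cv u′) (cv v′) (dv u′) (dv v′) ⟩
    (σ u * σ v - 1ℤ) * cross u v
      ≡⟨ flipFactor-vanishes (inQuad45 C D u) (inQuad45 C D v) (cross-vanishes u v) ⟩
    0ℤ ∎
    where
    u′ = Fin.opposite u
    v′ = Fin.opposite v
    X = cv u * cv v + dv u * dv v
    Y = cv v′ * cv u′ + dv v′ * dv u′
    factor : ∀ s t a b c d a′ b′ c′ d′ →
      (s * t - 1ℤ) * (a * b + c * d) + (t * s - 1ℤ) * (b′ * a′ + d′ * c′)
        ≡ (s * t - 1ℤ) * ((a * b + c * d) + (a′ * b′ + c′ * d′))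
    factor = solve-∀

  Δ-pair : ∀ {j k} → j < n → k < n → Δ j k + Δ (n ∸ suc k) (n ∸ suc j) ≡ 0ℤ
  Δ-pair j<n k<n =
    subst₂ (λ j k → Δ j k + Δ (n ∸ suc k) (n ∸ suc j) ≡ 0ℤ) (toℕ-fromℕ< j<n) (toℕ-fromℕ< k<n)
      (subst₂ (λ j′ k′ → Δ (toℕ u) (toℕ v) + Δ j′ k′ ≡ 0ℤ) (opposite-prop v) (opposite-prop u)
        (Δ-pair-opposite u v))
    where
    u = fromℕ< j<n
    v = fromℕ< k<n

  Δ-out : ∀ j {k} → n ≤ k → Δ j k ≡ 0ℤ
  Δ-out j n≤k
    rewrite atℕ-out (C̃ C D) n≤k | atℕ-out (D̃ C D) n≤k | atℕ-out C n≤k | atℕ-out D n≤k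
    = zeros (atℕ (C̃ C D) j) (atℕ (D̃ C D) j) (atℕ C j) (atℕ D j)
    where
    zeros : ∀ a b c d → (a * 0ℤ + b * 0ℤ) - (c * 0ℤ + d * 0ℤ) ≡ 0ℤ
    zeros = solve-∀

  ∑Δ≡0 : ∀ m → ∑.fold< n (λ j → Δ j (j ℕ.+ m)) ≡ 0ℤ
  ∑Δ≡0 m = begin
    ∑.fold< n lagΔ
      ≡⟨ ∑.fold<-take lagΔ (ℕP.m∸n≤m n m) (λ j n∸m≤j → Δ-out j (∸≤⇒≤+ n∸m≤j)) ⟩
    ∑.fold< (n ∸ m) lagΔ
      ≡⟨ ∑-antisymmetric (n ∸ m) lagΔ pair ⟩
    0ℤ
      ∎
    where
    lagΔ : ℕ → ℤ
    lagΔ j = Δ j (j ℕ.+ m)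
    pair : ∀ l → l < n ∸ m → lagΔ l + lagΔ (n ∸ m ∸ suc l) ≡ 0ℤ
    pair l l<n∸m with reflect-lag m n l<n∸m
    ... | e₁ , e₂ = subst₂ (λ j k → lagΔ l + Δ j k ≡ 0ℤ) (sym e₁) (sym e₂)
                           (Δ-pair (ℕP.<-≤-trans l<n∸m (ℕP.m∸n≤m n m)) (<∸⇒+< l<n∸m))

  correlation-preserved-nonneg : ∀ m → N (C̃ C D) (+ m) + N (D̃ C D) (+ m) ≡ N C (+ m) + N D (+ m)
  correlation-preserved-nonneg m = begin
    N (C̃ C D) (+ m) + N (D̃ C D) (+ m)
      ≡⟨ N+N≡∑ (C̃ C D) (D̃ C D) m ⟩
    ∑.fold< n (λ j → correlationTerm (C̃ C D) (D̃ C D) j (j ℕ.+ m))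
      ≡⟨ ∑.fold<-cong n (λ j _ → add-difference (correlationTerm (C̃ C D) (D̃ C D) j (j ℕ.+ m))
                                                 (correlationTerm C D j (j ℕ.+ m))) ⟩
    ∑.fold< n (λ j → correlationTerm C D j (j ℕ.+ m) + Δ j (j ℕ.+ m))
      ≡⟨ ∑.fold<-distrib n (λ j → correlationTerm C D j (j ℕ.+ m)) (λ j → Δ j (j ℕ.+ m)) ⟩
    ∑.fold< n (λ j → correlationTerm C D j (j ℕ.+ m)) + ∑.fold< n (λ j → Δ j (j ℕ.+ m))
      ≡⟨ cong (_+_ (∑.fold< n (λ j → correlationTerm C D j (j ℕ.+ m)))) (∑Δ≡0 m) ⟩
    ∑.fold< n (λ j → correlationTerm C D j (j ℕ.+ m)) + 0ℤ
      ≡⟨ ℤP.+-identityʳ _ ⟩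
    ∑.fold< n (λ j → correlationTerm C D j (j ℕ.+ m))
      ≡⟨ N+N≡∑ C D m ⟨
    N C (+ m) + N D (+ m)
      ∎
    where
    add-difference : ∀ a b → a ≡ b + (a - b)
    add-difference = solve-∀

  correlation-preserved : ∀ i → N (C̃ C D) i + N (D̃ C D) i ≡ N C i + N D i
  correlation-preserved (+ m)     = correlation-preserved-nonneg m
  correlation-preserved -[1+ m ] = begin
    N (C̃ C D) -[1+ m ] + N (D̃ C D) -[1+ m ]   ≡⟨ cong₂ _+_ (N-even (C̃ C D) m) (N-even (D̃ C D) m) ⟩
    N (C̃ C D) (+ suc m) + N (D̃ C D) (+ suc m) ≡⟨ correlation-preserved-nonneg (suc m) ⟩
    N C (+ suc m) + N D (+ suc m)             ≡⟨ cong₂ _+_ (N-even C m) (N-even D m) ⟨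
    N C -[1+ m ] + N D -[1+ m ]               ∎

IsBS-respects-N+N : ∀ {n} (A B : Vec Sign (suc n)) (C D C′ D′ : Vec Sign n) →
  (∀ i → N C′ i + N D′ i ≡ N C i + N D i) → IsBS n A B C D → IsBS n A B C′ D′
IsBS-respects-N+N A B C D C′ D′ same bs i i≢0 = begin
  N A i + N B i + N C′ i + N D′ i     ≡⟨ ℤP.+-assoc (N A i + N B i) (N C′ i) (N D′ i) ⟩
  N A i + N B i + (N C′ i + N D′ i)   ≡⟨ cong (_+_ (N A i + N B i)) (same i) ⟩
  N A i + N B i + (N C i + N D i)     ≡⟨ ℤP.+-assoc (N A i + N B i) (N C i) (N D i) ⟨
  N A i + N B i + N C i + N D i       ≡⟨ bs i i≢0 ⟩
  0ℤ                                  ∎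
  where open ≡-Reasoning

mainTheorem1 : (n : ℕ) → n ≥ 1 →
    (A B : Vec Sign (suc n)) (C D : Vec Sign n) → IsBS n A B C D →
    ((i : ℤ) → N (C̃ C D) i + N (D̃ C D) i ≡ N C i + N D i)
    × IsBS n A B (C̃ C D) (D̃ C D)
mainTheorem1 n _ A B C D bs = preserved , IsBS-respects-N+N A B C D (C̃ C D) (D̃ C D) preserved bs
  where
  open QuadsOfBS A B C D bs using (quadProduct≡+)
  open Swap45 C D quadProduct≡+ using () renaming (correlation-preserved to preserved)
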